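{- Let $H=(V,E,\ell)$ be an edge-colored hypergraph with colors $[k]$ and let $b\ge 1$ be an integer. Let $\{x_v^c, x_e : v\in V, c\in[k], e\in E\}$ be an optimal solution of the linear program $$\min \sum_{e\in E} x_e \quad\text{s.t.}\quad \sum_{c=1}^k x_v^c\ge k-b\ \ \forall v\in V;\qquad x_v^c\le x_e\ \ \forall c\in[k],\ \forall e\in E \text{ with } \ell(e)=c,\ \forall v\in e;\qquad x_v^c,x_e\in[0,1].$$ Let $\rho\in(0,1)$ be any threshold such that $b/\rho$ is an integer, and let $\lambda$ be the coloring that assigns color $c$ to node $v$ if and only if $x_v^c<1-\rho$. Then $\lambda$ is a bicriteria $\left(\frac{1}{1-\rho},\ \frac{1}{\rho}-\frac{1}{b}\right)$-approximation for Local Overlapping ECC: the number of mistakes of $\lambda$ is at most $\frac{1}{1-\rho}$ times the optimal number of mistakes for Local Overlapping ECC with budget $b$, and every node receives at most $\left(\frac1\rho-\frac1b\right)b$ colors.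
   Context: An edge-colored hypergraph $H=(V,E,\ell)$ consists of a finite node set $V$, a finite collection $E$ of hyperedges (subsets of $V$), and a labeling $\ell:E\to[k]$. A coloring is a map $\lambda:V\to 2^{[k]}$; it makes a mistake at $e\in E$ if some $v\in e$ has $\ell(e)\notin\lambda(v)$. Local Overlapping ECC with budget $b\ge1$: minimize the number of hyperedges at which $\lambda$ makes a mistake over colorings with $|\lambda(v)|\le b$ for all $v$. A bicriteria $(\alpha,\beta)$-approximation is a coloring whose number of mistakes is within a factor $\alpha$ of the optimum of the problem and which violates the budget constraint by a factor at most $\beta$.
   Formalization: The LP variables $x_v^c$ and $x_e$ take rational values, and optimality of the solution is judged only against rational feasible solutions. -}

module Defs where

open import Data.Nat as ℕ using (ℕ; zero; suc)
open import Data.Nat.Base using (>-nonZero)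
open import Data.Integer using (+_)
open import Data.Fin using (Fin; zero; suc)
open import Data.Fin.Subset using (Subset; _∈_; _∉_; ∣_∣)
open import Data.Vec using (tabulate)
open import Data.Product using (∃-syntax; _×_)
open import Data.Rational
  using (ℚ; 0ℚ; 1ℚ; _+_; _-_; -_; _<_; _≤_; _/_; 1/_; Positive; positive)
open import Data.Rational.Properties
  using (pos⇒nonZero; _<?_; +-monoˡ-<; +-inverseʳ)
open import Relation.Nullary using (does)
open import Relation.Binary.PropositionalEquality using (subst)

ℕtoℚ : ℕ → ℚ
ℕtoℚ n = (+ n) / 1

recip : (p : ℚ) → 0ℚ < p → ℚ
recip p h = 1/_ p {{pos⇒nonZero p {{positive h}}}}

invℕ : (b : ℕ) → 1 ℕ.≤ b → ℚ
invℕ b h = _/_ (+ 1) b {{>-nonZero h}}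

0<1-ρ : (ρ : ℚ) → ρ < 1ℚ → 0ℚ < 1ℚ - ρ
0<1-ρ ρ h = subst (_< 1ℚ - ρ) (+-inverseʳ ρ) (+-monoˡ-< (- ρ) h)

sumℚ : {n : ℕ} → (Fin n → ℚ) → ℚ
sumℚ {zero}  f = 0ℚ
sumℚ {suc n} f = f zero + sumℚ (λ i → f (suc i))

-- Edge-colored hypergraphs: nodes Fin n, hyperedges indexed by Fin m
-- (so E may be a collection with repetitions), colors Fin k.

record Hypergraph (n m k : ℕ) : Set where
  field
    edge  : Fin m → Subset n
    label : Fin m → Fin k
open Hypergraph public

Coloring : ℕ → ℕ → Set
Coloring n k = Fin n → Subset k

Mistake : {n m k : ℕ} → Hypergraph n m k → Coloring n k → Fin m → Set
Mistake H col e = ∃[ v ] (v ∈ edge H e × label H e ∉ col v)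

open import Data.Fin.Properties using (any?)
open import Data.Fin.Subset.Properties using (_∈?_)
open import Relation.Nullary using (Dec; ¬?; _×-dec_)

mistake? : {n m k : ℕ} (H : Hypergraph n m k) (col : Coloring n k) (e : Fin m) →
           Dec (Mistake H col e)
mistake? H col e = any? (λ v → (v ∈? edge H e) ×-dec ¬? (label H e ∈? col v))

mistakeSet : {n m k : ℕ} → Hypergraph n m k → Coloring n k → Subset m
mistakeSet H col = tabulate (λ e → does (mistake? H col e))

numMistakes : {n m k : ℕ} → Hypergraph n m k → Coloring n k → ℕ
numMistakes H col = ∣ mistakeSet H col ∣

WithinBudget : {n k : ℕ} → ℕ → Coloring n k → Set
WithinBudget b col = ∀ v → ∣ col v ∣ ℕ.≤ b

record LPSol (n m k : ℕ) : Set where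
  field
    xv : Fin n → Fin k → ℚ
    xe : Fin m → ℚ
open LPSol public

objective : {n m k : ℕ} → LPSol n m k → ℚ
objective x = sumℚ (xe x)

record LPFeasible {n m k : ℕ} (H : Hypergraph n m k) (b : ℕ) (x : LPSol n m k) : Set where
  field
    cover   : ∀ v → ℕtoℚ k - ℕtoℚ b ≤ sumℚ (xv x v)
    edgeC   : ∀ e v → v ∈ edge H e → xv x v (label H e) ≤ xe x e
    xv-lo   : ∀ v c → 0ℚ ≤ xv x v c
    xv-hi   : ∀ v c → xv x v c ≤ 1ℚ
    xe-lo   : ∀ e → 0ℚ ≤ xe x e
    xe-hi   : ∀ e → xe x e ≤ 1ℚ

LPOptimal : {n m k : ℕ} (H : Hypergraph n m k) (b : ℕ) (x : LPSol n m k) → Set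
LPOptimal {n} {m} {k} H b x =
  LPFeasible H b x × (∀ (y : LPSol n m k) → LPFeasible H b y → objective x ≤ objective y)

thresholdColoring : {n m k : ℕ} → LPSol n m k → ℚ → Coloring n k
thresholdColoring x ρ v = tabulate (λ c → does (xv x v c <? 1ℚ - ρ))

{-# OPTIONS --safe #-}
-- For any coloring within budget b, the indicator vectors x_v^c = [c ∉ λ(v)] and
-- x_e = [mistake at e] are LP-feasible with objective the number of mistakes, so the
-- LP optimum is a lower bound.  Rounding loses a factor 1/(1-ρ) on the hyperedges: a
-- mistake at e comes from some v ∈ e with x_v^{ℓ(e)} ≥ 1-ρ, whence x_e ≥ 1-ρ.  On the
-- nodes, each of the T colors kept at v has x_v^c < 1-ρ, so Σ_c x_v^c < k - ρT when
-- T > 0; with the covering constraint this gives ρT < b, i.e. T < b/ρ, and since b/ρ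
-- is an integer, T ≤ b/ρ - 1 = (1/ρ - 1/b) b.
module Submission where

open import Defs
open import Data.Nat using (ℕ)
open import Data.Nat as ℕ using ()
open import Data.Fin.Subset using (∣_∣)
open import Data.Product using (∃-syntax; _×_)
open import Data.Rational using (ℚ; 0ℚ; 1ℚ; _*_; _-_; _<_; _≤_)
open import Relation.Binary.PropositionalEquality using (_≡_)

open import Data.Nat using (zero; suc; z≤n; s≤s)
import Data.Nat.Properties as ℕP
import Data.Integer as ℤ
import Data.Integer.Properties as ℤP
open import Data.Nat.Coprimality using (1-coprimeTo; sym)
open import Data.Bool using (Bool; true; false; not)
open import Data.Fin using (Fin; zero; suc)
open import Data.Fin.Properties using (any?)
open import Data.Fin.Subset using (Subset; _∈_; _∉_)
open import Data.Vec using ([]; _∷_; lookup; tabulate)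
open import Data.Vec.Properties using (lookup∘tabulate; []=⇒lookup; lookup⇒[]=)
open import Data.Product using (_,_)
open import Data.Rational using (mkℚ; _/_; _+_; -_; positive; nonNegative)
open import Data.Rational.Properties
open import Data.Rational.Solver using (module +-*-Solver)
open import Function using (_∘_)
open import Relation.Nullary using (¬_; Dec; yes; no; does; contradiction)
open import Relation.Nullary.Decidable using (dec-true; dec-false)
open import Relation.Binary.PropositionalEquality
  using (refl; trans; cong; cong₂; subst; subst₂; module ≡-Reasoning)
  renaming (sym to ≡-sym)

open +-*-Solver

ℕtoℚ-mkℚ : ∀ n → ℕtoℚ n ≡ mkℚ (ℤ.+ n) 0 (sym (1-coprimeTo n))
ℕtoℚ-mkℚ n = normalize-coprime (sym (1-coprimeTo n))

ℕtoℚ-suc : ∀ n → ℕtoℚ (suc n) ≡ 1ℚ + ℕtoℚ n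
ℕtoℚ-suc n rewrite ℕtoℚ-mkℚ n =
  cong (_/ 1) (cong (ℤ._+_ (ℤ.+ 1)) (≡-sym (ℤP.*-identityʳ (ℤ.+ n))))

ℕtoℚ-nonNeg : ∀ n → 0ℚ ≤ ℕtoℚ n
ℕtoℚ-nonNeg n = nonNegative⁻¹ (ℕtoℚ n) {{normalize-nonNeg n 1}}

ℕtoℚ-mono-≤ : ∀ {a b} → a ℕ.≤ b → ℕtoℚ a ≤ ℕtoℚ b
ℕtoℚ-mono-≤ {zero}  {b}     z≤n     = ℕtoℚ-nonNeg b
ℕtoℚ-mono-≤ {suc a} {suc b} (s≤s p) rewrite ℕtoℚ-suc a | ℕtoℚ-suc b = +-monoʳ-≤ 1ℚ (ℕtoℚ-mono-≤ p)

ℕtoℚ-cancel-< : ∀ {a b} → ℕtoℚ a < ℕtoℚ b → a ℕ.< b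
ℕtoℚ-cancel-< {a} {b} a<b with a ℕP.<? b
... | yes p = p
... | no ¬p = contradiction (<-≤-trans a<b (ℕtoℚ-mono-≤ (ℕP.≮⇒≥ ¬p))) (<-irrefl refl)

ℕtoℚ-<⇒≤-1 : ∀ {a b} → ℕtoℚ a < ℕtoℚ b → ℕtoℚ a ≤ ℕtoℚ b - 1ℚ
ℕtoℚ-<⇒≤-1 {a} {b} a<b = subst (_≤ ℕtoℚ b - 1ℚ) 1+a-1≡a (+-monoˡ-≤ (- 1ℚ) 1+a≤b)
  where
  1+a≤b : 1ℚ + ℕtoℚ a ≤ ℕtoℚ b
  1+a≤b = subst (_≤ ℕtoℚ b) (ℕtoℚ-suc a) (ℕtoℚ-mono-≤ {suc a} {b} (ℕtoℚ-cancel-< {a} {b} a<b))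
  1+a-1≡a : 1ℚ + ℕtoℚ a - 1ℚ ≡ ℕtoℚ a
  1+a-1≡a = solve 1 (λ t → con 1ℚ :+ t :- con 1ℚ := t) refl (ℕtoℚ a)

recip-inverseˡ : ∀ p (0<p : 0ℚ < p) → recip p 0<p * p ≡ 1ℚ
recip-inverseˡ p 0<p = *-inverseˡ p {{pos⇒nonZero p {{positive 0<p}}}}

recip-pos : ∀ p (0<p : 0ℚ < p) → 0ℚ < recip p 0<p
recip-pos p 0<p = positive⁻¹ _ {{1/pos⇒pos p {{positive 0<p}}}}

invℕ-inverseˡ : ∀ b (1≤b : 1 ℕ.≤ b) → invℕ b 1≤b * ℕtoℚ b ≡ 1ℚ
invℕ-inverseˡ (suc b) _ = trans
  (cong₂ _*_ (normalize-coprime (1-coprimeTo (suc b))) (ℕtoℚ-mkℚ (suc b)))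
  (*-inverseˡ (mkℚ (ℤ.+ suc b) 0 (sym (1-coprimeTo (suc b)))))

*-recip-cancelʳ : ∀ p q (0<q : 0ℚ < q) → p * q * recip q 0<q ≡ p
*-recip-cancelʳ p q 0<q = begin
  p * q * r   ≡⟨ solve 3 (λ p q r → p :* q :* r := p :* (r :* q)) refl p q r ⟩
  p * (r * q) ≡⟨ cong (p *_) (recip-inverseˡ q 0<q) ⟩
  p * 1ℚ      ≡⟨ *-identityʳ p ⟩
  p           ∎
  where open ≡-Reasoning
        r = recip q 0<q

*≤⇒≤-recip* : ∀ p r q (0<q : 0ℚ < q) → p * q ≤ r → p ≤ recip q 0<q * r
*≤⇒≤-recip* p r q 0<q pq≤r = subst₂ _≤_ (*-recip-cancelʳ p q 0<q) (*-comm r _)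
  (*-monoʳ-≤-nonNeg (recip q 0<q) {{nonNegative (<⇒≤ (recip-pos q 0<q))}} pq≤r)

*<⇒<*-recip : ∀ p r q (0<q : 0ℚ < q) → p * q < r → p < r * recip q 0<q
*<⇒<*-recip p r q 0<q pq<r = subst (_< r * recip q 0<q) (*-recip-cancelʳ p q 0<q)
  (*-monoˡ-<-pos (recip q 0<q) {{positive (recip-pos q 0<q)}} pq<r)

+≡⇒-≤ : ∀ {p q r s} → p + q ≡ r → q ≤ s → r - s ≤ p
+≡⇒-≤ {p} {q} {r} {s} p+q≡r q≤s = subst (r - s ≤_) r-q≡p (+-monoʳ-≤ r (neg-antimono-≤ q≤s))
  where
  r-q≡p : r - q ≡ p
  r-q≡p = trans (cong (_- q) (≡-sym p+q≡r)) (solve 2 (λ p q → (p :+ q) :- q := p) refl p q)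

-≤∧+<⇒< : ∀ {p q r s} → s - r ≤ p → p + q < s → q < r
-≤∧+<⇒< {p} {q} {r} {s} s-r≤p p+q<s = subst₂ _<_
  (solve 3 (λ q r s → (s :- r) :+ q :- s :+ r := q) refl q r s)
  (solve 2 (λ r s → s :- s :+ r := r) refl r s)
  (+-monoˡ-< r (+-monoˡ-< (- s) (≤-<-trans (+-monoˡ-≤ q s-r≤p) p+q<s)))

indicator : Bool → ℚ
indicator true  = 1ℚ
indicator false = 0ℚ

indicator-nonNeg : ∀ β → 0ℚ ≤ indicator β
indicator-nonNeg true  = ≤ᵇ⇒≤ _
indicator-nonNeg false = ≤-refl

indicator-≤1 : ∀ β → indicator β ≤ 1ℚ
indicator-≤1 true  = ≤-refl
indicator-≤1 false = ≤ᵇ⇒≤ _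

indicator-not-+ : ∀ β → indicator (not β) + indicator β ≡ 1ℚ
indicator-not-+ true  = refl
indicator-not-+ false = refl

sumℚ-cong : ∀ {n} {f g : Fin n → ℚ} → (∀ i → f i ≡ g i) → sumℚ f ≡ sumℚ g
sumℚ-cong {zero}  f≡g = refl
sumℚ-cong {suc n} f≡g = cong₂ _+_ (f≡g zero) (sumℚ-cong (f≡g ∘ suc))

sumℚ-mono-≤ : ∀ {n} {f g : Fin n → ℚ} → (∀ i → f i ≤ g i) → sumℚ f ≤ sumℚ g
sumℚ-mono-≤ {zero}  f≤g = ≤-refl
sumℚ-mono-≤ {suc n} f≤g = +-mono-≤ (f≤g zero) (sumℚ-mono-≤ (f≤g ∘ suc))

sumℚ-mono-< : ∀ {n} {f g : Fin n → ℚ} → (∀ i → f i ≤ g i) → ∀ i → f i < g i → sumℚ f < sumℚ g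
sumℚ-mono-< f≤g zero    f<g = +-mono-<-≤ f<g (sumℚ-mono-≤ (f≤g ∘ suc))
sumℚ-mono-< f≤g (suc i) f<g = +-mono-≤-< (f≤g zero) (sumℚ-mono-< (f≤g ∘ suc) i f<g)

sumℚ-+ : ∀ {n} (f g : Fin n → ℚ) → sumℚ (λ i → f i + g i) ≡ sumℚ f + sumℚ g
sumℚ-+ {zero}  f g = refl
sumℚ-+ {suc n} f g = trans (cong (f zero + g zero +_) (sumℚ-+ (f ∘ suc) (g ∘ suc)))
  (solve 4 (λ a b c d → (a :+ b) :+ (c :+ d) := (a :+ c) :+ (b :+ d)) refl
    (f zero) (g zero) (sumℚ (f ∘ suc)) (sumℚ (g ∘ suc)))

sumℚ-*ʳ : ∀ {n} (f : Fin n → ℚ) a → sumℚ (λ i → f i * a) ≡ sumℚ f * a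
sumℚ-*ʳ {zero}  f a = ≡-sym (*-zeroˡ a)
sumℚ-*ʳ {suc n} f a = trans (cong (f zero * a +_) (sumℚ-*ʳ (f ∘ suc) a))
  (≡-sym (*-distribʳ-+ a (f zero) (sumℚ (f ∘ suc))))

sumℚ-zero : ∀ {n} {f : Fin n → ℚ} → (∀ i → f i ≡ 0ℚ) → sumℚ f ≡ 0ℚ
sumℚ-zero {zero}  f≡0 = refl
sumℚ-zero {suc n} f≡0 = cong₂ _+_ (f≡0 zero) (sumℚ-zero (f≡0 ∘ suc))

sumℚ-one : ∀ n → sumℚ {n} (λ _ → 1ℚ) ≡ ℕtoℚ n
sumℚ-one zero    = refl
sumℚ-one (suc n) = trans (cong (1ℚ +_) (sumℚ-one n)) (≡-sym (ℕtoℚ-suc n))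

∣∣≡sumℚ-indicator : ∀ {n} (p : Subset n) → ℕtoℚ ∣ p ∣ ≡ sumℚ (indicator ∘ lookup p)
∣∣≡sumℚ-indicator []          = refl
∣∣≡sumℚ-indicator (true ∷ p)  = trans (ℕtoℚ-suc ∣ p ∣) (cong (1ℚ +_) (∣∣≡sumℚ-indicator p))
∣∣≡sumℚ-indicator (false ∷ p) = trans (∣∣≡sumℚ-indicator p) (≡-sym (+-identityˡ _))

∣tabulate∣≡sumℚ-indicator : ∀ {n} (f : Fin n → Bool) → ℕtoℚ ∣ tabulate f ∣ ≡ sumℚ (indicator ∘ f)
∣tabulate∣≡sumℚ-indicator f =
  trans (∣∣≡sumℚ-indicator (tabulate f)) (sumℚ-cong (cong indicator ∘ lookup∘tabulate f))

sumℚ-indicator-∁+∣∣ : ∀ {n} (p : Subset n) → sumℚ (indicator ∘ not ∘ lookup p) + ℕtoℚ ∣ p ∣ ≡ ℕtoℚ n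
sumℚ-indicator-∁+∣∣ {n} p = begin
  sumℚ outside + ℕtoℚ ∣ p ∣          ≡⟨ cong (sumℚ outside +_) (∣∣≡sumℚ-indicator p) ⟩
  sumℚ outside + sumℚ inside         ≡⟨ ≡-sym (sumℚ-+ outside inside) ⟩
  sumℚ (λ i → outside i + inside i)  ≡⟨ sumℚ-cong (indicator-not-+ ∘ lookup p) ⟩
  sumℚ {n} (λ _ → 1ℚ)                ≡⟨ sumℚ-one n ⟩
  ℕtoℚ n                             ∎
  where
  open ≡-Reasoning
  outside inside : Fin n → ℚ
  outside = indicator ∘ not ∘ lookup p
  inside  = indicator ∘ lookup p

module _ {n m k : ℕ} (H : Hypergraph n m k) where

  coloringSolution : Coloring n k → LPSol n m k
  coloringSolution col = record
    { xv = λ v c → indicator (not (lookup (col v) c))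
    ; xe = λ e → indicator (does (mistake? H col e))
    }

  objective-coloringSolution : ∀ col → objective (coloringSolution col) ≡ ℕtoℚ (numMistakes H col)
  objective-coloringSolution col =
    ≡-sym (∣tabulate∣≡sumℚ-indicator (λ e → does (mistake? H col e)))

  lookup≡false⇒mistake : ∀ col e v → v ∈ edge H e →
    lookup (col v) (label H e) ≡ false → Mistake H col e
  lookup≡false⇒mistake col e v v∈e ℓ∉ =
    v , v∈e , λ ℓ∈ → contradiction (trans (≡-sym ([]=⇒lookup ℓ∈)) ℓ∉) λ ()

  coloringSolution-edge : ∀ col e v → v ∈ edge H e →
    indicator (not (lookup (col v) (label H e))) ≤ indicator (does (mistake? H col e))
  coloringSolution-edge col e v v∈e with lookup (col v) (label H e) in ℓ∈?
  ... | true  = indicator-nonNeg (does (mistake? H col e))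
  ... | false
    rewrite dec-true (mistake? H col e) (lookup≡false⇒mistake col e v v∈e ℓ∈?) = ≤-refl

  coloringSolution-feasible : ∀ b col → WithinBudget b col → LPFeasible H b (coloringSolution col)
  coloringSolution-feasible b col budget = record
    { cover = λ v → +≡⇒-≤ (sumℚ-indicator-∁+∣∣ (col v)) (ℕtoℚ-mono-≤ (budget v))
    ; edgeC = coloringSolution-edge col
    ; xv-lo = λ v c → indicator-nonNeg (not (lookup (col v) c))
    ; xv-hi = λ v c → indicator-≤1 (not (lookup (col v) c))
    ; xe-lo = λ e → indicator-nonNeg (does (mistake? H col e))
    ; xe-hi = λ e → indicator-≤1 (does (mistake? H col e))
    }

threshold-∉⇒≥ : ∀ {n m k} (x : LPSol n m k) ρ v c →
  c ∉ thresholdColoring x ρ v → 1ℚ - ρ ≤ xv x v c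
threshold-∉⇒≥ x ρ v c c∉ = ≮⇒≥ λ x<1-ρ → c∉ (lookup⇒[]= c _
  (trans (lookup∘tabulate _ c) (dec-true (xv x v c <? 1ℚ - ρ) x<1-ρ)))

<1-ρ⇒+ρ<1 : ∀ {y} ρ → y < 1ℚ - ρ → y + indicator true * ρ < 1ℚ
<1-ρ⇒+ρ<1 {y} ρ y<1-ρ = subst₂ _<_ (cong (y +_) (≡-sym (*-identityˡ ρ)))
  (solve 1 (λ p → con 1ℚ :- p :+ p := con 1ℚ) refl ρ) (+-monoˡ-< ρ y<1-ρ)

threshold-slack-≤ : ∀ {y} ρ (y<1-ρ? : Dec (y < 1ℚ - ρ)) →
  y ≤ 1ℚ → y + indicator (does y<1-ρ?) * ρ ≤ 1ℚ
threshold-slack-≤     ρ (yes y<1-ρ) _   = <⇒≤ (<1-ρ⇒+ρ<1 ρ y<1-ρ)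
threshold-slack-≤ {y} ρ (no _)      y≤1 =
  subst (_≤ 1ℚ) (≡-sym (trans (cong (y +_) (*-zeroˡ ρ)) (+-identityʳ y))) y≤1

threshold-slack-< : ∀ {y} ρ (y<1-ρ? : Dec (y < 1ℚ - ρ)) →
  y < 1ℚ - ρ → y + indicator (does y<1-ρ?) * ρ < 1ℚ
threshold-slack-< ρ (yes _)     y<1-ρ = <1-ρ⇒+ρ<1 ρ y<1-ρ
threshold-slack-< ρ (no  y≮1-ρ) y<1-ρ = contradiction y<1-ρ y≮1-ρ

module _ {n m k : ℕ} (H : Hypergraph n m k) {b : ℕ} {x : LPSol n m k}
         (feasible : LPFeasible H b x) (ρ : ℚ) where

  open LPFeasible feasible

  private
    λρ : Coloring n k
    λρ = thresholdColoring x ρ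

    keeps : Fin n → Fin k → Bool
    keeps v c = does (xv x v c <? 1ℚ - ρ)

    kept : Fin n → Fin k → ℚ
    kept v = indicator ∘ keeps v

  indicator-mistake*≤xe : ∀ e (d : Dec (Mistake H λρ e)) → indicator (does d) * (1ℚ - ρ) ≤ xe x e
  indicator-mistake*≤xe e (yes (v , v∈e , ℓ∉)) =
    subst (_≤ xe x e) (≡-sym (*-identityˡ (1ℚ - ρ)))
      (≤-trans (threshold-∉⇒≥ x ρ v (label H e) ℓ∉) (edgeC e v v∈e))
  indicator-mistake*≤xe e (no _) = subst (_≤ xe x e) (≡-sym (*-zeroˡ (1ℚ - ρ))) (xe-lo e)

  numMistakes-threshold*≤objective : ℕtoℚ (numMistakes H λρ) * (1ℚ - ρ) ≤ objective x
  numMistakes-threshold*≤objective = begin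
    ℕtoℚ (numMistakes H λρ) * (1ℚ - ρ)
      ≡⟨ cong (_* (1ℚ - ρ)) (∣tabulate∣≡sumℚ-indicator mistakes) ⟩
    sumℚ (indicator ∘ mistakes) * (1ℚ - ρ)
      ≡⟨ ≡-sym (sumℚ-*ʳ (indicator ∘ mistakes) (1ℚ - ρ)) ⟩
    sumℚ (λ e → indicator (mistakes e) * (1ℚ - ρ))
      ≤⟨ sumℚ-mono-≤ (λ e → indicator-mistake*≤xe e (mistake? H λρ e)) ⟩
    objective x ∎
    where
    open ≤-Reasoning
    mistakes : Fin m → Bool
    mistakes e = does (mistake? H λρ e)

  sumℚ-xv+∣threshold∣*ρ : ∀ v →
    sumℚ (λ c → xv x v c + kept v c * ρ) ≡ sumℚ (xv x v) + ℕtoℚ ∣ λρ v ∣ * ρ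
  sumℚ-xv+∣threshold∣*ρ v = begin
    sumℚ (λ c → xv x v c + kept v c * ρ)
      ≡⟨ sumℚ-+ (xv x v) (λ c → kept v c * ρ) ⟩
    sumℚ (xv x v) + sumℚ (λ c → kept v c * ρ)
      ≡⟨ cong (sumℚ (xv x v) +_) (sumℚ-*ʳ (kept v) ρ) ⟩
    sumℚ (xv x v) + sumℚ (kept v) * ρ
      ≡⟨ cong (λ t → sumℚ (xv x v) + t * ρ) (≡-sym (∣tabulate∣≡sumℚ-indicator (keeps v))) ⟩
    sumℚ (xv x v) + ℕtoℚ ∣ λρ v ∣ * ρ ∎
    where open ≡-Reasoning

  ∣threshold∣≡0 : ∀ v → (∀ c → ¬ xv x v c < 1ℚ - ρ) → ℕtoℚ ∣ λρ v ∣ ≡ 0ℚ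
  ∣threshold∣≡0 v none = trans (∣tabulate∣≡sumℚ-indicator (keeps v))
    (sumℚ-zero (λ c → cong indicator (dec-false (xv x v c <? 1ℚ - ρ) (none c))))

  sumℚ-xv+∣threshold∣*ρ<k : ∀ v c → xv x v c < 1ℚ - ρ →
    sumℚ (xv x v) + ℕtoℚ ∣ λρ v ∣ * ρ < ℕtoℚ k
  sumℚ-xv+∣threshold∣*ρ<k v c xc<1-ρ = subst₂ _<_ (sumℚ-xv+∣threshold∣*ρ v) (sumℚ-one k)
    (sumℚ-mono-< {f = λ c → xv x v c + kept v c * ρ} {g = λ _ → 1ℚ}
      (λ c → threshold-slack-≤ ρ (xv x v c <? 1ℚ - ρ) (xv-hi v c)) c
      (threshold-slack-< ρ (xv x v c <? 1ℚ - ρ) xc<1-ρ))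

  ∣threshold∣*ρ<b : 0ℚ < ℕtoℚ b → ∀ v → ℕtoℚ ∣ λρ v ∣ * ρ < ℕtoℚ b
  ∣threshold∣*ρ<b 0<b v with any? (λ c → xv x v c <? 1ℚ - ρ)
  ... | yes (c , xc<1-ρ) = -≤∧+<⇒< {sumℚ (xv x v)} {ℕtoℚ ∣ λρ v ∣ * ρ}
                             (cover v) (sumℚ-xv+∣threshold∣*ρ<k v c xc<1-ρ)
  ... | no  none         = subst (_< ℕtoℚ b) (≡-sym Tρ≡0) 0<b
    where
    Tρ≡0 : ℕtoℚ ∣ λρ v ∣ * ρ ≡ 0ℚ
    Tρ≡0 = trans (cong (_* ρ) (∣threshold∣≡0 v (λ c xc<1-ρ → none (c , xc<1-ρ)))) (*-zeroˡ ρ)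

  numMistakes-threshold*≤numMistakes : (∀ y → LPFeasible H b y → objective x ≤ objective y) →
    ∀ col → WithinBudget b col → ℕtoℚ (numMistakes H λρ) * (1ℚ - ρ) ≤ ℕtoℚ (numMistakes H col)
  numMistakes-threshold*≤numMistakes optimal col budget = begin
    ℕtoℚ (numMistakes H λρ) * (1ℚ - ρ)
      ≤⟨ numMistakes-threshold*≤objective ⟩
    objective x
      ≤⟨ optimal (coloringSolution H col) (coloringSolution-feasible H b col budget) ⟩
    objective (coloringSolution H col)
      ≡⟨ objective-coloringSolution H col ⟩
    ℕtoℚ (numMistakes H col) ∎
    where open ≤-Reasoning

*ρ<b⇒≤[1/ρ-1/b]*b : ∀ {T b N} ρ (0<ρ : 0ℚ < ρ) (1≤b : 1 ℕ.≤ b) →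
  ℕtoℚ T * ρ < ℕtoℚ b → ℕtoℚ b * recip ρ 0<ρ ≡ ℕtoℚ N →
  ℕtoℚ T ≤ (recip ρ 0<ρ - invℕ b 1≤b) * ℕtoℚ b
*ρ<b⇒≤[1/ρ-1/b]*b {T} {b} {N} ρ 0<ρ 1≤b Tρ<b b/ρ≡N = begin
  ℕtoℚ T            ≤⟨ ℕtoℚ-<⇒≤-1 {T} {N} (subst (ℕtoℚ T <_) b/ρ≡N (*<⇒<*-recip _ _ ρ 0<ρ Tρ<b)) ⟩
  ℕtoℚ N - 1ℚ       ≡⟨ cong₂ _-_ (≡-sym b/ρ≡N) (≡-sym (invℕ-inverseˡ b 1≤b)) ⟩
  B * r - i * B     ≡⟨ solve 3 (λ B r i → B :* r :- i :* B := (r :- i) :* B) refl B r i ⟩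
  (r - i) * B       ∎
  where open ≤-Reasoning
        B = ℕtoℚ b
        r = recip ρ 0<ρ
        i = invℕ b 1≤b

theorem4p2 : {n m k : ℕ} (H : Hypergraph n m k) (b : ℕ) (1≤b : 1 ℕ.≤ b)
    (x : LPSol n m k) → LPOptimal H b x →
    (ρ : ℚ) (0<ρ : 0ℚ < ρ) (ρ<1 : ρ < 1ℚ) →
    (∃[ N ] (ℕtoℚ b * recip ρ 0<ρ ≡ ℕtoℚ N)) →
    ((col : Coloring n k) → WithinBudget b col →
    ℕtoℚ (numMistakes H (thresholdColoring x ρ))
    ≤ recip (1ℚ - ρ) (0<1-ρ ρ ρ<1) * ℕtoℚ (numMistakes H col))
    × (∀ v → ℕtoℚ ∣ thresholdColoring x ρ v ∣
    ≤ (recip ρ 0<ρ - invℕ b 1≤b) * ℕtoℚ b)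
theorem4p2 H b 1≤b x (feasible , optimal) ρ 0<ρ ρ<1 (N , b/ρ≡N) = approximation , budget
  where
  approximation : ∀ col → WithinBudget b col → ℕtoℚ (numMistakes H (thresholdColoring x ρ))
                    ≤ recip (1ℚ - ρ) (0<1-ρ ρ ρ<1) * ℕtoℚ (numMistakes H col)
  approximation col withinBudget = *≤⇒≤-recip*
    (ℕtoℚ (numMistakes H (thresholdColoring x ρ))) (ℕtoℚ (numMistakes H col)) (1ℚ - ρ) (0<1-ρ ρ ρ<1)
    (numMistakes-threshold*≤numMistakes H feasible ρ optimal col withinBudget)

  0<b : 0ℚ < ℕtoℚ b
  0<b = <-≤-trans (<-trans 0<ρ ρ<1) (ℕtoℚ-mono-≤ 1≤b)

  budget : ∀ v → ℕtoℚ ∣ thresholdColoring x ρ v ∣ ≤ (recip ρ 0<ρ - invℕ b 1≤b) * ℕtoℚ b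
  budget v = *ρ<b⇒≤[1/ρ-1/b]*b {∣ thresholdColoring x ρ v ∣} {b} {N} ρ 0<ρ 1≤b
    (∣threshold∣*ρ<b H feasible ρ 0<b v) b/ρ≡N
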